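{- Let $\mathcal{S}$ be the set of all set partition statistics, thought of as functions $f:\bigcup_{n\ge 0}\Pi(n)\to\mathbb{Q}$. Then $\mathcal{S}$ is closed under pointwise scaling, addition and multiplication: if $f_1,f_2\in\mathcal{S}$ and $a\in\mathbb{Q}$, then there exist statistics $g_a,g_+,g_*\in\mathcal{S}$ such that for every set partition $\lambda$, $$a f_1(\lambda)=g_a(\lambda),\qquad f_1(\lambda)+f_2(\lambda)=g_+(\lambda),\qquad f_1(\lambda)f_2(\lambda)=g_*(\lambda).$$ Furthermore $\deg(g_a)\le\deg(f_1)$, $\deg(g_+)\le\max(\deg(f_1),\deg(f_2))$ and $\deg(g_*)\le\deg(f_1)+\deg(f_2)$. In particular $\mathcal{S}$ is a filtered $\mathbb{Q}$-algebra under these operations.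
   Context: For $n\ge 0$, $\Pi(n)$ is the set of set partitions of $[n]=\{1,\dots,n\}$. For $\lambda\in\Pi(n)$ write $i\sim_\lambda j$ if $i,j$ lie in the same block of $\lambda$. Let $\mathbf{First}(\lambda)$ be the set of elements of $[n]$ that are the smallest in their block, $\mathbf{Last}(\lambda)$ the set of elements that are the largest in their block, and $\mathbf{Arc}(\lambda)$ the set of pairs $(i,j)$ with $i<j$, $i\sim_\lambda j$, and $j$ the smallest element of the block of $i$ that is greater than $i$. A pattern of length $k$ is a tuple $\underline{P}=(P,\mathbf{F},\mathbf{L},\mathbf{A},\mathbf{C})$ where $P$ is a set partition of $[k]$, $\mathbf{F},\mathbf{L}\subseteq[k]$ and $\mathbf{A},\mathbf{C}\subseteq[k]\times[k]$. An occurrence of $\underline P$ in $\lambda\in\Pi(n)$ is a tuple $s=(x_1,\dots,x_k)$ with $x_i\in[n]$ such that: (1) $x_1<x_2<\dots<x_k$; (2) $x_i\sim_\lambda x_j$ iff $i\sim_P j$; (3) $x_i\in\mathbf{First}(\lambda)$ if $i\in\mathbf F$; (4) $x_i\in\mathbf{Last}(\lambda)$ if $i\in\mathbf L$; (5) $(x_i,x_j)\in\mathbf{Arc}(\lambda)$ if $(i,j)\in\mathbf A$; (6) $|x_i-x_j|=1$ if $(i,j)\in\mathbf C$. A simple statistic is determined by a pattern $\underline P$ of length $k$ and a polynomial $Q\in\mathbb{Z}[y_1,\dots,y_k,m]$: for $\lambda\in\Pi(n)$, $f_{\underline P,Q}(\lambda)=\sum_{s}Q(x_1,\dots,x_k,n)$,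 the sum over all occurrences $s=(x_1,\dots,x_k)$ of $\underline P$ in $\lambda$. Its degree is $k+\deg Q$. A statistic is a finite $\mathbb{Q}$-linear combination of simple statistics; its degree is the minimum, over all such representations, of the maximum degree of a simple statistic appearing in the representation. -}

module Defs where

open import Data.Nat as ℕ using (ℕ; zero; suc; _⊔_; ∣_-_∣)
open import Data.Integer as ℤ using (ℤ)
open import Data.Rational as ℚ using (ℚ; 0ℚ)
open import Data.Fin as Fin using (Fin; toℕ)
open import Data.Fin.Properties as FinP using (all?; _<?_)
open import Data.Vec as Vec using (Vec; []; _∷_; lookup)
open import Data.List as List using (List; []; _∷_; concatMap; map; filter; foldr)
open import Data.List.Relation.Unary.All as All using (All)
open import Data.Product using (Σ; _×_; _,_; proj₁; proj₂; ∃)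
open import Data.Bool using (Bool)
open import Relation.Binary.PropositionalEquality using (_≡_)
open import Relation.Nullary using (¬_; Dec)
open import Relation.Nullary.Decidable using (_×-dec_; _→-dec_; ¬?)
open import Relation.Unary using (Decidable)
import Data.Nat.Properties as ℕP
import Data.Nat.ListAction as NLA

-- The ground set [n] = {1,…,n} is represented by Fin n, element i : Fin n
-- standing for the number toℕ i + 1.  A set partition is encoded
-- canonically by the map sending each element to the smallest element of
-- its block; the two laws below say exactly that (blk i is in the block of
-- i, and it is the least element there).  This encoding is in bijection
-- with set partitions of [n].

record SetPartition (n : ℕ) : Set where
  field
    blk      : Fin n → Fin n
    blk-≤    : ∀ i → blk i Fin.≤ i
    blk-idem : ∀ i → blk (blk i) ≡ blk i
open SetPartition public

_∼⟨_⟩_ : ∀ {n} → Fin n → SetPartition n → Fin n → Set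
i ∼⟨ λ' ⟩ j = blk λ' i ≡ blk λ' j

First : ∀ {n} → SetPartition n → Fin n → Set
First λ' i = blk λ' i ≡ i

Last : ∀ {n} → SetPartition n → Fin n → Set
Last λ' i = ∀ j → i Fin.< j → ¬ (j ∼⟨ λ' ⟩ i)

Arc : ∀ {n} → SetPartition n → Fin n → Fin n → Set
Arc λ' i j = (i Fin.< j) × (i ∼⟨ λ' ⟩ j) × (∀ l → i Fin.< l → l Fin.< j → ¬ (l ∼⟨ λ' ⟩ i))

-- |x_i - x_j| = 1  (values are 1-based, the shift cancels)
Adjacent : ∀ {n} → Fin n → Fin n → Set
Adjacent i j = ∣ toℕ i - toℕ j ∣ ≡ 1

-- Patterns (P , F , L , A , C) of length k.  The subsets F, L ⊆ [k] and
-- A, C ⊆ [k]×[k] are given as finite lists of their elements.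

record Pattern (k : ℕ) : Set where
  field
    P : SetPartition k
    F : List (Fin k)
    L : List (Fin k)
    A : List (Fin k × Fin k)
    C : List (Fin k × Fin k)
open Pattern public

record Occurrence {k n : ℕ} (pat : Pattern k) (λ' : SetPartition n) (x : Vec (Fin n) k) : Set where
  field
    increasing : ∀ i j → i Fin.< j → lookup x i Fin.< lookup x j
    same-block : ∀ i j → ((lookup x i ∼⟨ λ' ⟩ lookup x j) → (i ∼⟨ P pat ⟩ j))
                       × ((i ∼⟨ P pat ⟩ j) → (lookup x i ∼⟨ λ' ⟩ lookup x j))
    firsts     : All (λ i → First λ' (lookup x i)) (F pat)
    lasts      : All (λ i → Last λ' (lookup x i)) (L pat)
    arcs       : All (λ ij → Arc λ' (lookup x (proj₁ ij)) (lookup x (proj₂ ij))) (A pat)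
    adjacents  : All (λ ij → Adjacent (lookup x (proj₁ ij)) (lookup x (proj₂ ij))) (C pat)

private
  ∼? : ∀ {n} (λ' : SetPartition n) i j → Dec (i ∼⟨ λ' ⟩ j)
  ∼? λ' i j = blk λ' i FinP.≟ blk λ' j

  first? : ∀ {n} (λ' : SetPartition n) i → Dec (First λ' i)
  first? λ' i = blk λ' i FinP.≟ i

  last? : ∀ {n} (λ' : SetPartition n) i → Dec (Last λ' i)
  last? λ' i = all? (λ j → (i <? j) →-dec ¬? (∼? λ' j i))

  arc? : ∀ {n} (λ' : SetPartition n) i j → Dec (Arc λ' i j)
  arc? λ' i j = (i <? j) ×-dec (∼? λ' i j)
                ×-dec all? (λ l → (i <? l) →-dec ((l <? j) →-dec ¬? (∼? λ' l i)))

  adj? : ∀ {n} (i j : Fin n) → Dec (Adjacent i j)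
  adj? i j = ∣ toℕ i - toℕ j ∣ ℕP.≟ 1

occurrence? : ∀ {k n} (pat : Pattern k) (λ' : SetPartition n) → Decidable (Occurrence pat λ')
occurrence? pat λ' x =
  Relation.Nullary.Decidable.map′
    (λ { (a , b , c , d , e , f) → record { increasing = λ i j → a i j ; same-block = b
                                            ; firsts = c ; lasts = d ; arcs = e ; adjacents = f } })
    (λ o → Occurrence.increasing o , Occurrence.same-block o , Occurrence.firsts o
         , Occurrence.lasts o , Occurrence.arcs o , Occurrence.adjacents o)
    (all? (λ i → all? (λ j → (i <? j) →-dec (lookup x i <? lookup x j)))
     ×-dec all? (λ i → all? (λ j → ((∼? λ' (lookup x i) (lookup x j)) →-dec (∼? (P pat) i j))
                                   ×-dec ((∼? (P pat) i j) →-dec (∼? λ' (lookup x i) (lookup x j)))))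
     ×-dec All.all? (λ i → first? λ' (lookup x i)) (F pat)
     ×-dec All.all? (λ i → last? λ' (lookup x i)) (L pat)
     ×-dec All.all? (λ ij → arc? λ' (lookup x (proj₁ ij)) (lookup x (proj₂ ij))) (A pat)
     ×-dec All.all? (λ ij → adj? (lookup x (proj₁ ij)) (lookup x (proj₂ ij))) (C pat))
  where import Relation.Nullary.Decidable

tuples : (k n : ℕ) → List (Vec (Fin n) k)
tuples zero    n = [] ∷ []
tuples (suc k) n = concatMap (λ i → map (i ∷_) (tuples k n)) (List.allFin n)

occurrences : ∀ {k n} → Pattern k → SetPartition n → List (Vec (Fin n) k)
occurrences pat λ' = filter (occurrence? pat λ') (tuples _ _)

-- Polynomials Q ∈ ℤ[y_1,…,y_k,m], as finite lists of monomials
-- c · y_1^{e_1} ⋯ y_k^{e_k} · m^{e}.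

record Monomial (k : ℕ) : Set where
  field
    coeff : ℤ
    expY  : Vec ℕ k
    expM  : ℕ
open Monomial public

Poly : ℕ → Set
Poly k = List (Monomial k)

monoDeg : ∀ {k} → Monomial k → ℕ
monoDeg μ = Vec.sum (expY μ) ℕ.+ expM μ

polyDeg : ∀ {k} → Poly k → ℕ
polyDeg Q = foldr _⊔_ 0 (map monoDeg Q)

-- value of a monomial at (y_1,…,y_k) = (x_1,…,x_k) (1-based) and m = n
evalMono : ∀ {k n} → Monomial k → Vec (Fin n) k → ℤ
evalMono {k} {n} μ x =
  coeff μ ℤ.* ℤ.+ (NLA.product (Vec.toList (Vec.zipWith (λ xi e → (toℕ xi ℕ.+ 1) ℕ.^ e) x (expY μ))) ℕ.* (n ℕ.^ expM μ))

evalPoly : ∀ {k n} → Poly k → Vec (Fin n) k → ℤ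
evalPoly Q x = foldr (λ μ z → evalMono μ x ℤ.+ z) (ℤ.+ 0) Q

Stat : Set
Stat = (n : ℕ) → SetPartition n → ℚ

record Simple : Set where
  field
    len : ℕ
    pat : Pattern len
    pol : Poly len
open Simple public

simpleDeg : Simple → ℕ
simpleDeg s = len s ℕ.+ polyDeg (pol s)

evalSimple : Simple → Stat
evalSimple s n λ' =
  (foldr (λ x z → evalPoly (pol s) x ℤ.+ z) (ℤ.+ 0) (occurrences (pat s) λ')) ℚ./ 1

Rep : Set
Rep = List (ℚ × Simple)

⟦_⟧ : Rep → Stat
⟦ R ⟧ n λ' = foldr (λ cs q → (proj₁ cs ℚ.* evalSimple (proj₂ cs) n λ') ℚ.+ q) 0ℚ R

repDeg : Rep → ℕ
repDeg R = foldr _⊔_ 0 (map (λ cs → simpleDeg (proj₂ cs)) R)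

IsStatistic : Stat → Set
IsStatistic f = Σ Rep λ R → ∀ n λ' → ⟦ R ⟧ n λ' ≡ f n λ'

-- deg f ≤ D  (the degree is the minimum over representations of repDeg)
DegreeAtMost : Stat → ℕ → Set
DegreeAtMost f D = Σ Rep λ R → (∀ n λ' → ⟦ R ⟧ n λ' ≡ f n λ') × (repDeg R ℕ.≤ D)

-- A product of two simple statistics is a sum over pairs (x, y) of occurrences of
-- their patterns.  Such a pair is determined by its merged increasing tuple w, the
-- interleaving recording which entries of w come from x, from y or from both, and
-- the partition that λ induces on the entries of w.  Grouping the pairs by this
-- shape writes the product as a sum of simple statistics whose patterns have at most
-- k + k' entries and whose polynomials are products of the original ones, so degrees
-- add.  Scaling and addition act directly on the representing linear combinations.

module Submission where

open import Defs
open import Data.Product using (Σ; _×_)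
open import Relation.Binary.PropositionalEquality using (_≡_)

open import Algebra.Bundles using (CommutativeSemiring; CommutativeRing; CommutativeMonoid)
import Algebra.Properties.CommutativeSemigroup as CommSemigroupProperties
open import Data.Empty using (⊥-elim)
open import Data.Fin as Fin using (Fin; zero; suc; toℕ)
import Data.Fin.Properties as FinP
import Data.Integer as ℤ
import Data.Integer.Properties as ℤP
open import Data.List as List using (List; []; _∷_; _++_; map; concatMap; filter; foldr; cartesianProduct; upTo)
open import Data.List.Membership.Propositional using (_∈_; find; lose)
import Data.List.Membership.Propositional.Properties as ∈P
open import Data.List.Membership.Propositional.Properties.WithK using (unique∧set⇒bag)
open import Data.List.Relation.Binary.BagAndSetEquality using (∼bag⇒↭)
open import Data.List.Relation.Binary.Permutation.Propositional as Perm using (_↭_)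
import Data.List.Relation.Unary.All as All
import Data.List.Relation.Unary.All.Properties as AllP
open import Data.List.Relation.Unary.Any using (here; there)
open import Data.List.Relation.Unary.Unique.Propositional using (Unique)
import Data.List.Relation.Unary.Unique.Propositional.Properties as UniqueP
open import Data.List.Relation.Unary.AllPairs using ([]; _∷_)
import Data.Nat as ℕ
import Data.Nat.Coprimality as Coprimality
import Data.Nat.ListAction as ℕList
import Data.Nat.Properties as ℕP
open import Data.Product using (_,_; proj₁; proj₂; uncurry)
import Data.Rational as ℚ
import Data.Rational.Properties as ℚP
open import Data.Sum using (_⊎_; inj₁; inj₂)
open import Data.Vec as Vec using (Vec; []; _∷_; lookup)
import Data.Vec.Properties as VecP
open import Data.Vec.Relation.Unary.All as VecAll using ([]; _∷_)
import Data.Vec.Relation.Unary.All.Properties as VecAllP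
open import Data.Vec.Relation.Unary.AllPairs as VecAllPairs using ([]; _∷_)
open import Function using (_∘_; _⇔_; mk⇔)
open import Relation.Binary.Definitions using (tri<; tri≈; tri>)
open import Relation.Nullary using (¬_; Dec; yes; no)
open import Relation.Nullary.Decidable using (_×-dec_; _→-dec_; map′)

private variable
  X Y : Set

module ListSum {c ℓ} (S : CommutativeSemiring c ℓ) where
  open CommutativeSemiring S
  open import Relation.Binary.Reasoning.Setoid setoid

  sumBy : (X → Carrier) → List X → Carrier
  sumBy g = foldr (λ x z → g x + z) 0#

  sumBy-++ : (g : X → Carrier) (xs ys : List X) → sumBy g (xs ++ ys) ≈ sumBy g xs + sumBy g ys
  sumBy-++ g []       ys = sym (+-identityˡ _)
  sumBy-++ g (x ∷ xs) ys = trans (+-congˡ (sumBy-++ g xs ys)) (sym (+-assoc (g x) _ _))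

  sumBy-cong : {g h : X → Carrier} (xs : List X) → (∀ x → x ∈ xs → g x ≈ h x) → sumBy g xs ≈ sumBy h xs
  sumBy-cong []       e = refl
  sumBy-cong (x ∷ xs) e = +-cong (e x (here _≡_.refl)) (sumBy-cong xs (λ y p → e y (there p)))

  sumBy-map : (g : Y → Carrier) (f : X → Y) (xs : List X) → sumBy g (map f xs) ≈ sumBy (g ∘ f) xs
  sumBy-map g f []       = refl
  sumBy-map g f (x ∷ xs) = +-congˡ (sumBy-map g f xs)

  sumBy-concatMap : (g : Y → Carrier) (f : X → List Y) (xs : List X) →
    sumBy g (concatMap f xs) ≈ sumBy (sumBy g ∘ f) xs
  sumBy-concatMap g f []       = refl
  sumBy-concatMap g f (x ∷ xs) = trans (sumBy-++ g (f x) (concatMap f xs)) (+-congˡ (sumBy-concatMap g f xs))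

  *-distribˡ-sumBy : (a : Carrier) (g : X → Carrier) (xs : List X) → a * sumBy g xs ≈ sumBy (λ x → a * g x) xs
  *-distribˡ-sumBy a g []       = zeroʳ a
  *-distribˡ-sumBy a g (x ∷ xs) = trans (distribˡ a (g x) _) (+-congˡ (*-distribˡ-sumBy a g xs))

  *-distribʳ-sumBy : (a : Carrier) (g : X → Carrier) (xs : List X) → sumBy g xs * a ≈ sumBy (λ x → g x * a) xs
  *-distribʳ-sumBy a g xs = begin
    sumBy g xs * a            ≈⟨ *-comm _ a ⟩
    a * sumBy g xs            ≈⟨ *-distribˡ-sumBy a g xs ⟩
    sumBy (λ x → a * g x) xs  ≈⟨ sumBy-cong xs (λ x _ → *-comm a (g x)) ⟩
    sumBy (λ x → g x * a) xs  ∎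

  sumBy-cartesianProduct : (g : X → Carrier) (h : Y → Carrier) (xs : List X) (ys : List Y) →
    sumBy g xs * sumBy h ys ≈ sumBy (λ p → g (proj₁ p) * h (proj₂ p)) (cartesianProduct xs ys)
  sumBy-cartesianProduct g h []       ys = zeroˡ (sumBy h ys)
  sumBy-cartesianProduct g h (x ∷ xs) ys = begin
    (g x + sumBy g xs) * sumBy h ys
      ≈⟨ distribʳ (sumBy h ys) (g x) (sumBy g xs) ⟩
    g x * sumBy h ys + sumBy g xs * sumBy h ys
      ≈⟨ +-cong (trans (*-distribˡ-sumBy (g x) h ys) (sym (sumBy-map gh (x ,_) ys)))
                (sumBy-cartesianProduct g h xs ys) ⟩
    sumBy gh (map (x ,_) ys) + sumBy gh (cartesianProduct xs ys)
      ≈⟨ sym (sumBy-++ gh (map (x ,_) ys) _) ⟩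
    sumBy gh (cartesianProduct (x ∷ xs) ys) ∎
    where
    gh : _ → Carrier
    gh p = g (proj₁ p) * h (proj₂ p)

  sumBy-↭ : (g : X → Carrier) {xs ys : List X} → xs ↭ ys → sumBy g xs ≈ sumBy g ys
  sumBy-↭ g Perm.refl         = refl
  sumBy-↭ g (Perm.prep x p)   = +-congˡ (sumBy-↭ g p)
  sumBy-↭ g (Perm.swap x y p) = trans (sym (+-assoc (g x) (g y) _))
    (trans (+-cong (+-comm (g x) (g y)) (sumBy-↭ g p)) (+-assoc (g y) (g x) _))
  sumBy-↭ g (Perm.trans p q)  = trans (sumBy-↭ g p) (sumBy-↭ g q)

  sumBy-unique : (g : X → Carrier) {xs ys : List X} → Unique xs → Unique ys →
    (∀ {z} → z ∈ xs ⇔ z ∈ ys) → sumBy g xs ≈ sumBy g ys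
  sumBy-unique g uxs uys same = sumBy-↭ g (∼bag⇒↭ (unique∧set⇒bag uxs uys same))

open import Data.Nat using (ℕ; _+_; _⊔_)
open import Data.Rational using (ℚ; _*_) renaming (_+_ to _+ℚ_)
open import Relation.Binary.PropositionalEquality
  using (refl; sym; trans; cong; cong₂; subst; subst₂; _≗_; module ≡-Reasoning)

private variable
  j k k' n : ℕ

module ℤΣ = ListSum ℤP.+-*-commutativeSemiring
module ℚΣ = ListSum (CommutativeRing.commutativeSemiring ℚP.+-*-commutativeRing)

toℚ : ℤ.ℤ → ℚ
toℚ z = z ℚ./ 1

toℚ≡mkℚ : ∀ z → toℚ z ≡ ℚ.mkℚ z 0 (Coprimality.sym (Coprimality.1-coprimeTo ℤ.∣ z ∣))
toℚ≡mkℚ (ℤ.+ m)     = ℚP.normalize-coprime (Coprimality.sym (Coprimality.1-coprimeTo m))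
toℚ≡mkℚ ℤ.-[1+ m ]  = cong ℚ.-_ (ℚP.normalize-coprime (Coprimality.sym (Coprimality.1-coprimeTo (ℕ.suc m))))

toℚ-+ : ∀ a b → toℚ (a ℤ.+ b) ≡ toℚ a +ℚ toℚ b
toℚ-+ a b = sym (trans (cong₂ _+ℚ_ (toℚ≡mkℚ a) (toℚ≡mkℚ b))
                       (cong toℚ (cong₂ ℤ._+_ (ℤP.*-identityʳ a) (ℤP.*-identityʳ b))))

toℚ-* : ∀ a b → toℚ (a ℤ.* b) ≡ toℚ a * toℚ b
toℚ-* a b = sym (cong₂ _*_ (toℚ≡mkℚ a) (toℚ≡mkℚ b))

toℚ-sumBy : (g : X → ℤ.ℤ) (xs : List X) → toℚ (ℤΣ.sumBy g xs) ≡ ℚΣ.sumBy (toℚ ∘ g) xs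
toℚ-sumBy g []       = refl
toℚ-sumBy g (x ∷ xs) = trans (toℚ-+ (g x) _) (cong (toℚ (g x) +ℚ_) (toℚ-sumBy g xs))

maxBy : (X → ℕ) → List X → ℕ
maxBy f xs = foldr _⊔_ 0 (map f xs)

maxBy-≤ : (f : X → ℕ) (xs : List X) {D : ℕ} → (∀ x → x ∈ xs → f x ℕ.≤ D) → maxBy f xs ℕ.≤ D
maxBy-≤ f []       h = ℕ.z≤n
maxBy-≤ f (x ∷ xs) h = ℕP.⊔-lub (h x (here refl)) (maxBy-≤ f xs (λ y p → h y (there p)))

≤-maxBy : (f : X → ℕ) (xs : List X) {x : X} → x ∈ xs → f x ℕ.≤ maxBy f xs
≤-maxBy f (y ∷ xs) (here refl) = ℕP.m≤m⊔n (f y) _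
≤-maxBy f (y ∷ xs) (there p)   = ℕP.≤-trans (≤-maxBy f xs p) (ℕP.m≤n⊔m (f y) _)

unique-concatMap⁺ : (f : X → List Y) {xs : List X} → Unique xs → (∀ {x} → x ∈ xs → Unique (f x)) →
  (∀ {x x' y} → x ∈ xs → x' ∈ xs → y ∈ f x → y ∈ f x' → x ≡ x') → Unique (concatMap f xs)
unique-concatMap⁺ f {[]}     _          _     _        = []
unique-concatMap⁺ f {x ∷ xs} (x∉ ∷ uxs) ufibre disjoint =
  UniqueP.++⁺ (ufibre (here refl))
    (unique-concatMap⁺ f uxs (ufibre ∘ there) (λ p p' → disjoint (there p) (there p')))
    separate
  where
  separate : ∀ {y} → ¬ (y ∈ f x × y ∈ concatMap f xs)
  separate (p , q) with find (∈P.∈-concatMap⁻ f q)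
  ... | x' , x'∈ , q' with disjoint (here refl) (there x'∈) p q'
  ... | refl = All.lookup x∉ x'∈ refl

∈-tuples : (x : Vec (Fin n) k) → x ∈ tuples k n
∈-tuples []      = here refl
∈-tuples {n} {ℕ.suc k} (a ∷ x) =
  ∈P.∈-concatMap⁺ (λ i → map (i ∷_) (tuples k n)) (lose (∈P.∈-allFin a) (∈P.∈-map⁺ (a ∷_) (∈-tuples x)))

tuples-unique : ∀ k n → Unique (tuples k n)
tuples-unique ℕ.zero    n = All.[] ∷ []
tuples-unique (ℕ.suc k) n = unique-concatMap⁺ _ (UniqueP.allFin⁺ n)
  (λ _ → UniqueP.map⁺ VecP.∷-injectiveʳ (tuples-unique k n)) disjoint
  where
  disjoint : ∀ {i i' x} → i ∈ List.allFin n → i' ∈ List.allFin n →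
    x ∈ map (i ∷_) (tuples k n) → x ∈ map (i' ∷_) (tuples k n) → i ≡ i'
  disjoint _ _ p q with ∈P.∈-map⁻ _ p | ∈P.∈-map⁻ _ q
  ... | _ , _ , refl | _ , _ , e = VecP.∷-injectiveˡ e

occurrences-unique : (pat : Pattern k) (λ' : SetPartition n) → Unique (occurrences pat λ')
occurrences-unique {k} {n} pat λ' = UniqueP.filter⁺ (occurrence? pat λ') (tuples-unique k n)

∈-occurrences⁺ : {pat : Pattern k} {λ' : SetPartition n} {x : Vec (Fin n) k} →
  Occurrence pat λ' x → x ∈ occurrences pat λ'
∈-occurrences⁺ {pat = pat} {λ'} {x} = ∈P.∈-filter⁺ (occurrence? pat λ') (∈-tuples x)

∈-occurrences⁻ : {pat : Pattern k} {λ' : SetPartition n} {x : Vec (Fin n) k} →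
  x ∈ occurrences pat λ' → Occurrence pat λ' x
∈-occurrences⁻ {k} {n} {pat} {λ'} p = proj₂ (∈P.∈-filter⁻ (occurrence? pat λ') {xs = tuples k n} p)

Sorted : Vec (Fin n) k → Set
Sorted = VecAllPairs.AllPairs Fin._<_

sorted⇒lookup-< : {x : Vec (Fin n) k} → Sorted x → ∀ i j → i Fin.< j → lookup x i Fin.< lookup x j
sorted⇒lookup-< (a<x ∷ _) zero    (suc j) _            = VecAllP.lookup⁺ a<x j
sorted⇒lookup-< (_ ∷ sx)  (suc i) (suc j) (ℕ.s≤s i<j) = sorted⇒lookup-< sx i j i<j

lookup-<⇒sorted : (x : Vec (Fin n) k) → (∀ i j → i Fin.< j → lookup x i Fin.< lookup x j) → Sorted x
lookup-<⇒sorted []      mono = []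
lookup-<⇒sorted (a ∷ x) mono =
  VecAllP.lookup⁻ (λ j → mono zero (suc j) (ℕ.s≤s ℕ.z≤n)) ∷ lookup-<⇒sorted x (λ i j i<j → mono (suc i) (suc j) (ℕ.s≤s i<j))

-- Interleavings

-- An interleaving of a k-tuple and a k'-tuple into a j-tuple: each entry of the
-- merged tuple comes from the left tuple, the right tuple, or from both at once.
data Interleaving : ℕ → ℕ → ℕ → Set where
  []    : Interleaving 0 0 0
  left  : Interleaving k k' j → Interleaving (ℕ.suc k) k' (ℕ.suc j)
  right : Interleaving k k' j → Interleaving k (ℕ.suc k') (ℕ.suc j)
  both  : Interleaving k k' j → Interleaving (ℕ.suc k) (ℕ.suc k') (ℕ.suc j)

module _ {A : Set} where

  splitˡ : Interleaving k k' j → Vec A j → Vec A k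
  splitˡ []        []      = []
  splitˡ (left ω)  (a ∷ w) = a ∷ splitˡ ω w
  splitˡ (right ω) (a ∷ w) = splitˡ ω w
  splitˡ (both ω)  (a ∷ w) = a ∷ splitˡ ω w

  splitʳ : Interleaving k k' j → Vec A j → Vec A k'
  splitʳ []        []      = []
  splitʳ (left ω)  (a ∷ w) = splitʳ ω w
  splitʳ (right ω) (a ∷ w) = a ∷ splitʳ ω w
  splitʳ (both ω)  (a ∷ w) = a ∷ splitʳ ω w

  split : Interleaving k k' j → Vec A j → Vec A k × Vec A k'
  split ω w = splitˡ ω w , splitʳ ω w

  split-injective : (ω : Interleaving k k' j) {w w' : Vec A j} → split ω w ≡ split ω w' → w ≡ w'
  split-injective []        {[]}    {[]}      _  = refl
  split-injective (left ω)  {a ∷ w} {a' ∷ w'} eq with refl , eqˡ ← VecP.∷-injective (cong proj₁ eq) =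
    cong (a ∷_) (split-injective ω (cong₂ _,_ eqˡ (cong proj₂ eq)))
  split-injective (right ω) {a ∷ w} {a' ∷ w'} eq with refl , eqʳ ← VecP.∷-injective (cong proj₂ eq) =
    cong (a ∷_) (split-injective ω (cong₂ _,_ (cong proj₁ eq) eqʳ))
  split-injective (both ω)  {a ∷ w} {a' ∷ w'} eq with refl , eqˡ ← VecP.∷-injective (cong proj₁ eq) =
    cong (a ∷_) (split-injective ω (cong₂ _,_ eqˡ (VecP.∷-injectiveʳ (cong proj₂ eq))))

  All-splitˡ : {P : A → Set} (ω : Interleaving k k' j) {w : Vec A j} → VecAll.All P w → VecAll.All P (splitˡ ω w)
  All-splitˡ []        []         = []
  All-splitˡ (left ω)  (p ∷ ps) = p ∷ All-splitˡ ω ps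
  All-splitˡ (right ω) (p ∷ ps) = All-splitˡ ω ps
  All-splitˡ (both ω)  (p ∷ ps) = p ∷ All-splitˡ ω ps

  All-splitʳ : {P : A → Set} (ω : Interleaving k k' j) {w : Vec A j} → VecAll.All P w → VecAll.All P (splitʳ ω w)
  All-splitʳ []        []         = []
  All-splitʳ (left ω)  (p ∷ ps) = All-splitʳ ω ps
  All-splitʳ (right ω) (p ∷ ps) = p ∷ All-splitʳ ω ps
  All-splitʳ (both ω)  (p ∷ ps) = p ∷ All-splitʳ ω ps

embedˡ : Interleaving k k' j → Fin k → Fin j
embedˡ (left ω)  zero    = zero
embedˡ (left ω)  (suc i) = suc (embedˡ ω i)
embedˡ (right ω) i       = suc (embedˡ ω i)
embedˡ (both ω)  zero    = zero
embedˡ (both ω)  (suc i) = suc (embedˡ ω i)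

embedʳ : Interleaving k k' j → Fin k' → Fin j
embedʳ (left ω)  i       = suc (embedʳ ω i)
embedʳ (right ω) zero    = zero
embedʳ (right ω) (suc i) = suc (embedʳ ω i)
embedʳ (both ω)  zero    = zero
embedʳ (both ω)  (suc i) = suc (embedʳ ω i)

lookup-splitˡ : {A : Set} (ω : Interleaving k k' j) (w : Vec A j) → lookup (splitˡ ω w) ≗ lookup w ∘ embedˡ ω
lookup-splitˡ (left ω)  (a ∷ w) zero    = refl
lookup-splitˡ (left ω)  (a ∷ w) (suc i) = lookup-splitˡ ω w i
lookup-splitˡ (right ω) (a ∷ w) i       = lookup-splitˡ ω w i
lookup-splitˡ (both ω)  (a ∷ w) zero    = refl
lookup-splitˡ (both ω)  (a ∷ w) (suc i) = lookup-splitˡ ω w i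

lookup-splitʳ : {A : Set} (ω : Interleaving k k' j) (w : Vec A j) → lookup (splitʳ ω w) ≗ lookup w ∘ embedʳ ω
lookup-splitʳ (left ω)  (a ∷ w) i       = lookup-splitʳ ω w i
lookup-splitʳ (right ω) (a ∷ w) zero    = refl
lookup-splitʳ (right ω) (a ∷ w) (suc i) = lookup-splitʳ ω w i
lookup-splitʳ (both ω)  (a ∷ w) zero    = refl
lookup-splitʳ (both ω)  (a ∷ w) (suc i) = lookup-splitʳ ω w i

sorted-splitˡ : (ω : Interleaving k k' j) {w : Vec (Fin n) j} → Sorted w → Sorted (splitˡ ω w)
sorted-splitˡ []        []         = []
sorted-splitˡ (left ω)  (a<w ∷ sw) = All-splitˡ ω a<w ∷ sorted-splitˡ ω sw
sorted-splitˡ (right ω) (a<w ∷ sw) = sorted-splitˡ ω sw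
sorted-splitˡ (both ω)  (a<w ∷ sw) = All-splitˡ ω a<w ∷ sorted-splitˡ ω sw

sorted-splitʳ : (ω : Interleaving k k' j) {w : Vec (Fin n) j} → Sorted w → Sorted (splitʳ ω w)
sorted-splitʳ []        []         = []
sorted-splitʳ (left ω)  (a<w ∷ sw) = sorted-splitʳ ω sw
sorted-splitʳ (right ω) (a<w ∷ sw) = All-splitʳ ω a<w ∷ sorted-splitʳ ω sw
sorted-splitʳ (both ω)  (a<w ∷ sw) = All-splitʳ ω a<w ∷ sorted-splitʳ ω sw

interleaving-length : Interleaving k k' j → j ℕ.≤ k + k'
interleaving-length []        = ℕ.z≤n
interleaving-length (left ω)  = ℕ.s≤s (interleaving-length ω)
interleaving-length {k} {ℕ.suc k'} (right ω) =
  ℕP.≤-trans (ℕ.s≤s (interleaving-length ω)) (ℕP.≤-reflexive (sym (ℕP.+-suc k k')))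
interleaving-length {ℕ.suc k} {ℕ.suc k'} (both ω) =
  ℕ.s≤s (ℕP.≤-trans (ℕP.m≤n⇒m≤1+n (interleaving-length ω)) (ℕP.≤-reflexive (sym (ℕP.+-suc k k'))))

interleavings : ∀ k k' j → List (Interleaving k k' j)
interleavings ℕ.zero    ℕ.zero     ℕ.zero    = [] ∷ []
interleavings (ℕ.suc k) ℕ.zero     (ℕ.suc j) = map left (interleavings k 0 j)
interleavings ℕ.zero    (ℕ.suc k') (ℕ.suc j) = map right (interleavings 0 k' j)
interleavings (ℕ.suc k) (ℕ.suc k') (ℕ.suc j) =
  map left (interleavings k (ℕ.suc k') j) ++ map right (interleavings (ℕ.suc k) k' j) ++ map both (interleavings k k' j)
interleavings _         _          _         = []

∈-interleavings : (ω : Interleaving k k' j) → ω ∈ interleavings k k' j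
∈-interleavings []                       = here refl
∈-interleavings {k' = ℕ.zero}  (left ω)  = ∈P.∈-map⁺ left (∈-interleavings ω)
∈-interleavings {k' = ℕ.suc _} (left ω)  = ∈P.∈-++⁺ˡ (∈P.∈-map⁺ left (∈-interleavings ω))
∈-interleavings {k = ℕ.zero}   (right ω) = ∈P.∈-map⁺ right (∈-interleavings ω)
∈-interleavings {ℕ.suc k} {ℕ.suc k'} {ℕ.suc j} (right ω) =
  ∈P.∈-++⁺ʳ (map left (interleavings k (ℕ.suc k') j)) (∈P.∈-++⁺ˡ (∈P.∈-map⁺ right (∈-interleavings ω)))
∈-interleavings {ℕ.suc k} {ℕ.suc k'} {ℕ.suc j} (both ω) =
  ∈P.∈-++⁺ʳ (map left (interleavings k (ℕ.suc k') j))
    (∈P.∈-++⁺ʳ (map right (interleavings (ℕ.suc k) k' j)) (∈P.∈-map⁺ both (∈-interleavings ω)))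

interleavings-unique : ∀ k k' j → Unique (interleavings k k' j)
interleavings-unique ℕ.zero    ℕ.zero     ℕ.zero    = All.[] ∷ []
interleavings-unique (ℕ.suc k) ℕ.zero     (ℕ.suc j) = UniqueP.map⁺ (λ { refl → refl }) (interleavings-unique k 0 j)
interleavings-unique ℕ.zero    (ℕ.suc k') (ℕ.suc j) = UniqueP.map⁺ (λ { refl → refl }) (interleavings-unique 0 k' j)
interleavings-unique (ℕ.suc k) (ℕ.suc k') (ℕ.suc j) =
  UniqueP.++⁺ (UniqueP.map⁺ (λ { refl → refl }) (interleavings-unique k (ℕ.suc k') j))
    (UniqueP.++⁺ (UniqueP.map⁺ (λ { refl → refl }) (interleavings-unique (ℕ.suc k) k' j))
                 (UniqueP.map⁺ (λ { refl → refl }) (interleavings-unique k k' j)) right∉both)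
    left∉rest
  where
  right∉both : ∀ {ω} → ¬ (ω ∈ map right (interleavings (ℕ.suc k) k' j) × ω ∈ map both (interleavings k k' j))
  right∉both (p , q) with ∈P.∈-map⁻ right p | ∈P.∈-map⁻ both q
  ... | _ , _ , refl | _ , _ , ()
  left∉rest : ∀ {ω} → ¬ (ω ∈ map left (interleavings k (ℕ.suc k') j)
                         × ω ∈ map right (interleavings (ℕ.suc k) k' j) ++ map both (interleavings k k' j))
  left∉rest (p , q) with ∈P.∈-map⁻ left p | ∈P.∈-++⁻ (map right (interleavings (ℕ.suc k) k' j)) q
  ... | _ , _ , refl | inj₁ q' with ∈P.∈-map⁻ right q'
  ...   | _ , _ , ()
  left∉rest (p , q) | _ , _ , refl | inj₂ q' with ∈P.∈-map⁻ both q'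
  ...   | _ , _ , ()
interleavings-unique ℕ.zero    ℕ.zero     (ℕ.suc j) = []
interleavings-unique (ℕ.suc k) ℕ.zero     ℕ.zero    = []
interleavings-unique ℕ.zero    (ℕ.suc k') ℕ.zero    = []
interleavings-unique (ℕ.suc k) (ℕ.suc k') ℕ.zero    = []

record Interleaved (V : ℕ → Set) (k k' : ℕ) : Set where
  constructor _⋈_
  field
    {width}      : ℕ
    interleaving : Interleaving k k' width
    entries      : V width
open Interleaved

module _ {n : ℕ} where

  private
    Merged : ℕ → ℕ → Set
    Merged = Interleaved (Vec (Fin n))

  consˡ : Fin n → Merged k k' → Merged (ℕ.suc k) k'
  consˡ a (ω ⋈ w) = left ω ⋈ (a ∷ w)

  consʳ : Fin n → Merged k k' → Merged k (ℕ.suc k')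
  consʳ a (ω ⋈ w) = right ω ⋈ (a ∷ w)

  consᵇ : Fin n → Merged k k' → Merged (ℕ.suc k) (ℕ.suc k')
  consᵇ a (ω ⋈ w) = both ω ⋈ (a ∷ w)

  merge : Vec (Fin n) k → Vec (Fin n) k' → Merged k k'
  merge []      []      = [] ⋈ []
  merge (a ∷ x) []      = consˡ a (merge x [])
  merge []      (b ∷ y) = consʳ b (merge [] y)
  merge (a ∷ x) (b ∷ y) with FinP.<-cmp a b
  ... | tri< _ _ _ = consˡ a (merge x (b ∷ y))
  ... | tri≈ _ _ _ = consᵇ a (merge x y)
  ... | tri> _ _ _ = consʳ b (merge (a ∷ x) y)

  split-merge : (x : Vec (Fin n) k) (y : Vec (Fin n) k') →
    let m = merge x y in split (interleaving m) (entries m) ≡ (x , y)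
  split-merge []      []      = refl
  split-merge (a ∷ x) []      = cong (λ (p : _ × _) → a ∷ proj₁ p , proj₂ p) (split-merge x [])
  split-merge []      (b ∷ y) = cong (λ (p : _ × _) → proj₁ p , b ∷ proj₂ p) (split-merge [] y)
  split-merge (a ∷ x) (b ∷ y) with FinP.<-cmp a b
  ... | tri< _ _ _    = cong (λ (p : _ × _) → a ∷ proj₁ p , proj₂ p) (split-merge x (b ∷ y))
  ... | tri≈ _ refl _ = cong (λ (p : _ × _) → a ∷ proj₁ p , a ∷ proj₂ p) (split-merge x y)
  ... | tri> _ _ _    = cong (λ (p : _ × _) → proj₁ p , b ∷ proj₂ p) (split-merge (a ∷ x) y)

  All-merge : {P : Fin n → Set} (x : Vec (Fin n) k) (y : Vec (Fin n) k') →
    VecAll.All P x → VecAll.All P y → VecAll.All P (entries (merge x y))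
  All-merge []      []      _          _          = []
  All-merge (a ∷ x) []      (pa ∷ px) py         = pa ∷ All-merge x [] px py
  All-merge []      (b ∷ y) px         (pb ∷ py) = pb ∷ All-merge [] y px py
  All-merge (a ∷ x) (b ∷ y) (pa ∷ px) (pb ∷ py) with FinP.<-cmp a b
  ... | tri< _ _ _ = pa ∷ All-merge x (b ∷ y) px (pb ∷ py)
  ... | tri≈ _ _ _ = pa ∷ All-merge x y px py
  ... | tri> _ _ _ = pb ∷ All-merge (a ∷ x) y (pa ∷ px) py

  sorted-merge : {x : Vec (Fin n) k} {y : Vec (Fin n) k'} → Sorted x → Sorted y → Sorted (entries (merge x y))
  sorted-merge {x = []}    {[]}    _          _          = []
  sorted-merge {x = a ∷ x} {[]}    (a<x ∷ sx) sy         = All-merge x [] a<x [] ∷ sorted-merge sx sy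
  sorted-merge {x = []}    {b ∷ y} sx         (b<y ∷ sy) = All-merge [] y [] b<y ∷ sorted-merge sx sy
  sorted-merge {x = a ∷ x} {b ∷ y} (a<x ∷ sx) (b<y ∷ sy) with FinP.<-cmp a b
  ... | tri< a<b _ _ =
    All-merge x (b ∷ y) a<x (a<b ∷ VecAll.map (FinP.<-trans a<b) b<y) ∷ sorted-merge sx (b<y ∷ sy)
  ... | tri≈ _ refl _ = All-merge x y a<x b<y ∷ sorted-merge sx sy
  ... | tri> _ _ b<a =
    All-merge (a ∷ x) y (b<a ∷ VecAll.map (FinP.<-trans b<a) a<x) b<y ∷ sorted-merge (a<x ∷ sx) sy

  merge-consˡ : ∀ a (x : Vec (Fin n) k) (y : Vec (Fin n) k') → VecAll.All (a Fin.<_) y →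
    merge (a ∷ x) y ≡ consˡ a (merge x y)
  merge-consˡ a x []      _           = refl
  merge-consˡ a x (b ∷ y) (a<b ∷ _) with FinP.<-cmp a b
  ... | tri< _ _ _     = refl
  ... | tri≈ a≮b _ _   = ⊥-elim (a≮b a<b)
  ... | tri> a≮b _ _   = ⊥-elim (a≮b a<b)

  merge-consʳ : ∀ b (x : Vec (Fin n) k) (y : Vec (Fin n) k') → VecAll.All (b Fin.<_) x →
    merge x (b ∷ y) ≡ consʳ b (merge x y)
  merge-consʳ b []      y _           = refl
  merge-consʳ b (a ∷ x) y (b<a ∷ _) with FinP.<-cmp a b
  ... | tri< _ _ b≮a = ⊥-elim (b≮a b<a)
  ... | tri≈ _ _ b≮a = ⊥-elim (b≮a b<a)
  ... | tri> _ _ _   = refl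

  merge-consᵇ : ∀ a (x : Vec (Fin n) k) (y : Vec (Fin n) k') → merge (a ∷ x) (a ∷ y) ≡ consᵇ a (merge x y)
  merge-consᵇ a x y with FinP.<-cmp a a
  ... | tri< _ a≢a _ = ⊥-elim (a≢a refl)
  ... | tri≈ _ _ _   = refl
  ... | tri> _ a≢a _ = ⊥-elim (a≢a refl)

  merge-split : (ω : Interleaving k k' j) {w : Vec (Fin n) j} → Sorted w → merge (splitˡ ω w) (splitʳ ω w) ≡ ω ⋈ w
  merge-split []        {[]}    []         = refl
  merge-split (left ω)  {a ∷ w} (a<w ∷ sw) =
    trans (merge-consˡ a _ _ (All-splitʳ ω a<w)) (cong (consˡ a) (merge-split ω sw))
  merge-split (right ω) {a ∷ w} (a<w ∷ sw) =
    trans (merge-consʳ a _ _ (All-splitˡ ω a<w)) (cong (consʳ a) (merge-split ω sw))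
  merge-split (both ω)  {a ∷ w} (a<w ∷ sw) =
    trans (merge-consᵇ a _ _) (cong (consᵇ a) (merge-split ω sw))

-- Set partitions of [j] as block vectors

CanonicalAt : Vec (Fin j) j → Fin j → Set
CanonicalAt v i = (lookup v i Fin.≤ i) × (lookup v (lookup v i) ≡ lookup v i)

canonicalAt? : (v : Vec (Fin j) j) (i : Fin j) → Dec (CanonicalAt v i)
canonicalAt? v i = (lookup v i FinP.≤? i) ×-dec (lookup v (lookup v i) FinP.≟ lookup v i)

IsBlockVector : Vec (Fin j) j → Set
IsBlockVector v = ∀ i → CanonicalAt v i

-- Where v violates the laws of a block map the entry is replaced by i itself,
-- so that every vector denotes a partition; on block vectors blk = lookup v.
blockOf : Vec (Fin j) j → Fin j → Fin j
blockOf v i with canonicalAt? v i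
... | yes _ = lookup v i
... | no _  = i

blockOf-spec : (v : Vec (Fin j) j) (i : Fin j) →
  (CanonicalAt v i × blockOf v i ≡ lookup v i) ⊎ (¬ CanonicalAt v i × blockOf v i ≡ i)
blockOf-spec v i with canonicalAt? v i
... | yes c = inj₁ (c , refl)
... | no ¬c = inj₂ (¬c , refl)

blockOf-canonical : (v : Vec (Fin j) j) {i : Fin j} → CanonicalAt v i → blockOf v i ≡ lookup v i
blockOf-canonical v {i} c with blockOf-spec v i
... | inj₁ (_ , e)  = e
... | inj₂ (¬c , _) = ⊥-elim (¬c c)

blockOf-fixed : (v : Vec (Fin j) j) {l : Fin j} → lookup v l ≡ l → blockOf v l ≡ l
blockOf-fixed v {l} fixed with blockOf-spec v l
... | inj₁ (_ , e) = trans e fixed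
... | inj₂ (_ , e) = e

blockOf-≤ : (v : Vec (Fin j) j) (i : Fin j) → blockOf v i Fin.≤ i
blockOf-≤ v i with blockOf-spec v i
... | inj₁ ((b≤i , _) , e) = subst (Fin._≤ i) (sym e) b≤i
... | inj₂ (_ , e)         = FinP.≤-reflexive e

blockOf-idem : (v : Vec (Fin j) j) (i : Fin j) → blockOf v (blockOf v i) ≡ blockOf v i
blockOf-idem v i with blockOf-spec v i
... | inj₁ ((_ , idem) , e) = trans (cong (blockOf v) e) (trans (blockOf-fixed v idem) (sym e))
... | inj₂ (_ , e)          = cong (blockOf v) e

toPartition : Vec (Fin j) j → SetPartition j
toPartition v = record { blk = blockOf v ; blk-≤ = blockOf-≤ v ; blk-idem = blockOf-idem v }

isBlockVector? : (v : Vec (Fin j) j) → Dec (IsBlockVector v)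
isBlockVector? v = FinP.all? (canonicalAt? v)

blockVectors : ∀ j → List (Vec (Fin j) j)
blockVectors j = filter isBlockVector? (tuples j j)

blockVectors-unique : ∀ j → Unique (blockVectors j)
blockVectors-unique j = UniqueP.filter⁺ isBlockVector? (tuples-unique j j)

∈-blockVectors⁺ : {v : Vec (Fin j) j} → IsBlockVector v → v ∈ blockVectors j
∈-blockVectors⁺ {v = v} = ∈P.∈-filter⁺ isBlockVector? (∈-tuples v)

∈-blockVectors⁻ : {v : Vec (Fin j) j} → v ∈ blockVectors j → IsBlockVector v
∈-blockVectors⁻ {j} p = proj₂ (∈P.∈-filter⁻ isBlockVector? {xs = tuples j j} p)

blockVector-unique : {v v' : Vec (Fin j) j} → IsBlockVector v → IsBlockVector v' →
  blk (toPartition v) ≗ blk (toPartition v') → v ≡ v'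
blockVector-unique {v = v} {v'} bv bv' same = begin
  v                         ≡⟨ VecP.tabulate∘lookup v ⟨
  Vec.tabulate (lookup v)   ≡⟨ VecP.tabulate-cong lookup-same ⟩
  Vec.tabulate (lookup v')  ≡⟨ VecP.tabulate∘lookup v' ⟩
  v'                        ∎
  where
  open ≡-Reasoning
  lookup-same : lookup v ≗ lookup v'
  lookup-same i = trans (sym (blockOf-canonical v (bv i))) (trans (same i) (blockOf-canonical v' (bv' i)))

record BlocksAgree (λ' : SetPartition n) (ρ : SetPartition k) (e : Fin k → Fin n) : Set where
  constructor blocksAgree
  field
    reflects  : ∀ i i' → e i ∼⟨ λ' ⟩ e i' → i ∼⟨ ρ ⟩ i'
    preserves : ∀ i i' → i ∼⟨ ρ ⟩ i' → e i ∼⟨ λ' ⟩ e i'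
open BlocksAgree

SameBlocks : SetPartition n → SetPartition k → (Fin k → Fin n) → Set
SameBlocks λ' ρ e = ∀ i i' → (e i ∼⟨ λ' ⟩ e i' → i ∼⟨ ρ ⟩ i') × (i ∼⟨ ρ ⟩ i' → e i ∼⟨ λ' ⟩ e i')

fromSameBlocks : {λ' : SetPartition n} {ρ : SetPartition k} {e : Fin k → Fin n} → SameBlocks λ' ρ e → BlocksAgree λ' ρ e
fromSameBlocks same = blocksAgree (λ i i' → proj₁ (same i i')) (λ i i' → proj₂ (same i i'))

toSameBlocks : {λ' : SetPartition n} {ρ : SetPartition k} {e : Fin k → Fin n} → BlocksAgree λ' ρ e → SameBlocks λ' ρ e
toSameBlocks agree i i' = reflects agree i i' , preserves agree i i'

occurrence-blocksAgree : {pat : Pattern k} {λ' : SetPartition n} {x : Vec (Fin n) k} →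
  Occurrence pat λ' x → BlocksAgree λ' (P pat) (lookup x)
occurrence-blocksAgree o = fromSameBlocks (Occurrence.same-block o)

blocksAgree? : (λ' : SetPartition n) (ρ : SetPartition k) (e : Fin k → Fin n) → Dec (BlocksAgree λ' ρ e)
blocksAgree? λ' ρ e = map′ fromSameBlocks toSameBlocks (FinP.all? λ i → FinP.all? λ i' →
  (∼? λ' (e i) (e i') →-dec ∼? ρ i i') ×-dec (∼? ρ i i' →-dec ∼? λ' (e i) (e i')))
  where
  ∼? : (π : SetPartition j) (a b : Fin j) → Dec (a ∼⟨ π ⟩ b)
  ∼? π a b = blk π a FinP.≟ blk π b

module _ {λ' : SetPartition n} where

  BlocksAgree-∘ : {π : SetPartition j} {ρ : SetPartition k} {f : Fin j → Fin n} {g : Fin k → Fin j} →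
    BlocksAgree λ' π f → BlocksAgree π ρ g → BlocksAgree λ' ρ (f ∘ g)
  BlocksAgree-∘ {g = g} f-agree g-agree = blocksAgree
    (λ i i' → reflects g-agree i i' ∘ reflects f-agree (g i) (g i'))
    (λ i i' → preserves f-agree (g i) (g i') ∘ preserves g-agree i i')

  BlocksAgree-cancelˡ : {π : SetPartition j} {ρ : SetPartition k} {f : Fin j → Fin n} {g : Fin k → Fin j} →
    BlocksAgree λ' π f → BlocksAgree λ' ρ (f ∘ g) → BlocksAgree π ρ g
  BlocksAgree-cancelˡ {g = g} f-agree fg-agree = blocksAgree
    (λ i i' → reflects fg-agree i i' ∘ preserves f-agree (g i) (g i'))
    (λ i i' → reflects f-agree (g i) (g i') ∘ preserves fg-agree i i')

  BlocksAgree-resp-≗ : {ρ : SetPartition k} {f g : Fin k → Fin n} → f ≗ g → BlocksAgree λ' ρ f → BlocksAgree λ' ρ g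
  BlocksAgree-resp-≗ f≗g f-agree = blocksAgree
    (λ i i' → reflects f-agree i i' ∘ subst₂ (λ a b → a ∼⟨ λ' ⟩ b) (sym (f≗g i)) (sym (f≗g i')))
    (λ i i' → subst₂ (λ a b → a ∼⟨ λ' ⟩ b) (f≗g i) (f≗g i') ∘ preserves f-agree i i')

  -- Both partitions then have the same relation, and blk picks the least element of a block.
  BlocksAgree-unique : {π π' : SetPartition j} {f : Fin j → Fin n} →
    BlocksAgree λ' π f → BlocksAgree λ' π' f → blk π ≗ blk π'
  BlocksAgree-unique {π = π} {π'} agree agree' i = FinP.≤-antisym blkπ≤blkπ' blkπ'≤blkπ
    where
    π⇒π' : ∀ a b → a ∼⟨ π ⟩ b → a ∼⟨ π' ⟩ b
    π⇒π' a b = reflects agree' a b ∘ preserves agree a b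
    π'⇒π : ∀ a b → a ∼⟨ π' ⟩ b → a ∼⟨ π ⟩ b
    π'⇒π a b = reflects agree a b ∘ preserves agree' a b
    blkπ'≤blkπ : blk π' i Fin.≤ blk π i
    blkπ'≤blkπ = subst (Fin._≤ blk π i) (π⇒π' (blk π i) i (blk-idem π i)) (blk-≤ π' (blk π i))
    blkπ≤blkπ' : blk π i Fin.≤ blk π' i
    blkπ≤blkπ' = subst (Fin._≤ blk π' i) (π'⇒π (blk π' i) i (blk-idem π' i)) (blk-≤ π (blk π' i))

least : {P : Fin j → Set} → (∀ l → Dec (P l)) → {i : Fin j} → P i →
  Σ (Fin j) λ l → P l × (∀ l' → P l' → l Fin.≤ l')
least {ℕ.suc j} P? pi with P? zero
... | yes p0 = zero , p0 , λ _ _ → ℕ.z≤n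
least {ℕ.suc j} P? {zero}  pi | no ¬p0 = ⊥-elim (¬p0 pi)
least {ℕ.suc j} {P} P? {suc i} pi | no ¬p0 with least (P? ∘ suc) pi
... | l , pl , l-least = suc l , pl , least-suc
  where
  least-suc : ∀ l' → P l' → suc l Fin.≤ l'
  least-suc zero     p = ⊥-elim (¬p0 p)
  least-suc (suc l') p = ℕ.s≤s (l-least l' p)

module _ (λ' : SetPartition n) (w : Vec (Fin n) j) where

  private
    SameBlock : Fin j → Fin j → Set
    SameBlock i l = lookup w l ∼⟨ λ' ⟩ lookup w i

    firstInBlock : (i : Fin j) → Σ (Fin j) λ l → SameBlock i l × (∀ l' → SameBlock i l' → l Fin.≤ l')
    firstInBlock i = least (λ l → blk λ' (lookup w l) FinP.≟ blk λ' (lookup w i)) refl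

  inducedBlocks : Vec (Fin j) j
  inducedBlocks = Vec.tabulate (proj₁ ∘ firstInBlock)

  private
    lookup-inducedBlocks : ∀ i → lookup inducedBlocks i ≡ proj₁ (firstInBlock i)
    lookup-inducedBlocks = VecP.lookup∘tabulate (proj₁ ∘ firstInBlock)

    first-sameBlock : ∀ i → SameBlock i (lookup inducedBlocks i)
    first-sameBlock i = subst (SameBlock i) (sym (lookup-inducedBlocks i)) (proj₁ (proj₂ (firstInBlock i)))

  inducedBlocks-≡⁺ : ∀ i i' → lookup w i ∼⟨ λ' ⟩ lookup w i' → lookup inducedBlocks i ≡ lookup inducedBlocks i'
  inducedBlocks-≡⁺ i i' i∼i' = begin
    lookup inducedBlocks i        ≡⟨ lookup-inducedBlocks i ⟩
    proj₁ (firstInBlock i)        ≡⟨ FinP.≤-antisym (minimal i i' (trans (proj₁ (proj₂ (firstInBlock i'))) (sym i∼i')))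
                                                    (minimal i' i (trans (proj₁ (proj₂ (firstInBlock i))) i∼i')) ⟩
    proj₁ (firstInBlock i')       ≡⟨ lookup-inducedBlocks i' ⟨
    lookup inducedBlocks i'       ∎
    where
    open ≡-Reasoning
    minimal : ∀ a b → SameBlock a (proj₁ (firstInBlock b)) → proj₁ (firstInBlock a) Fin.≤ proj₁ (firstInBlock b)
    minimal a b = proj₂ (proj₂ (firstInBlock a)) _

  inducedBlocks-≡⁻ : ∀ i i' → lookup inducedBlocks i ≡ lookup inducedBlocks i' → lookup w i ∼⟨ λ' ⟩ lookup w i'
  inducedBlocks-≡⁻ i i' e =
    trans (sym (first-sameBlock i)) (trans (cong (blk λ' ∘ lookup w) e) (first-sameBlock i'))

  inducedBlocks-isBlockVector : IsBlockVector inducedBlocks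
  inducedBlocks-isBlockVector i =
      subst (Fin._≤ i) (sym (lookup-inducedBlocks i)) (proj₂ (proj₂ (firstInBlock i)) i refl)
    , inducedBlocks-≡⁺ _ i (first-sameBlock i)

  inducedBlocks-agree : BlocksAgree λ' (toPartition inducedBlocks) (lookup w)
  inducedBlocks-agree = blocksAgree
    (λ i i' e → trans (canonical i) (trans (inducedBlocks-≡⁺ i i' e) (sym (canonical i'))))
    (λ i i' e → inducedBlocks-≡⁻ i i' (trans (sym (canonical i)) (trans e (canonical i'))))
    where
    canonical : ∀ a → blockOf inducedBlocks a ≡ lookup inducedBlocks a
    canonical a = blockOf-canonical inducedBlocks (inducedBlocks-isBlockVector a)

module _ {I J Z : Set} (Q : Z → Set) (x : J → Z) {f : I → J} {y : I → Z} (y≗x∘f : ∀ i → y i ≡ x (f i)) where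

  All-map⁻-reindex : {is : List I} → All.All (Q ∘ x) (map f is) → All.All (Q ∘ y) is
  All-map⁻-reindex = All.map (λ {i} → subst Q (sym (y≗x∘f i))) ∘ AllP.map⁻

  All-map⁺-reindex : {is : List I} → All.All (Q ∘ y) is → All.All (Q ∘ x) (map f is)
  All-map⁺-reindex = AllP.map⁺ ∘ All.map (λ {i} → subst Q (y≗x∘f i))

map² : {I J : Set} → (I → J) → I × I → J × J
map² f p = f (proj₁ p) , f (proj₂ p)

lookup² : {A : Set} → Vec A n → Fin n × Fin n → A × A
lookup² x = map² (lookup x)

lookup²-splitˡ : {A : Set} (ω : Interleaving k k' j) (w : Vec A j) → ∀ p → lookup² (splitˡ ω w) p ≡ lookup² w (map² (embedˡ ω) p)
lookup²-splitˡ ω w p = cong₂ _,_ (lookup-splitˡ ω w (proj₁ p)) (lookup-splitˡ ω w (proj₂ p))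

lookup²-splitʳ : {A : Set} (ω : Interleaving k k' j) (w : Vec A j) → ∀ p → lookup² (splitʳ ω w) p ≡ lookup² w (map² (embedʳ ω) p)
lookup²-splitʳ ω w p = cong₂ _,_ (lookup-splitʳ ω w (proj₁ p)) (lookup-splitʳ ω w (proj₂ p))

-- Patterns for pairs of occurrences

-- A shape records how two occurrences interleave and which blocks they share:
-- an interleaving into j positions and the block vector of a partition of [j].
Shape : ℕ → ℕ → Set
Shape = Interleaved (λ j → Vec (Fin j) j)

module ProductPattern (p₁ : Pattern k) (p₂ : Pattern k') where

  patternOf : (σ : Shape k k') → Pattern (width σ)
  patternOf (ω ⋈ v) = record
    { P = toPartition v
    ; F = map (embedˡ ω) (F p₁) ++ map (embedʳ ω) (F p₂)
    ; L = map (embedˡ ω) (L p₁) ++ map (embedʳ ω) (L p₂)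
    ; A = map (map² (embedˡ ω)) (A p₁) ++ map (map² (embedʳ ω)) (A p₂)
    ; C = map (map² (embedˡ ω)) (C p₁) ++ map (map² (embedʳ ω)) (C p₂)
    }

  Compatible : Shape k k' → Set
  Compatible (ω ⋈ v) = BlocksAgree (toPartition v) (P p₁) (embedˡ ω) × BlocksAgree (toPartition v) (P p₂) (embedʳ ω)

  compatible? : (σ : Shape k k') → Dec (Compatible σ)
  compatible? (ω ⋈ v) = blocksAgree? (toPartition v) (P p₁) (embedˡ ω) ×-dec blocksAgree? (toPartition v) (P p₂) (embedʳ ω)

  private
    withInterleaving : Interleaving k k' j → List (Shape k k')
    withInterleaving {j} ω = map (ω ⋈_) (blockVectors j)

    ofWidth : ℕ → List (Shape k k')
    ofWidth j = concatMap withInterleaving (interleavings k k' j)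

    allShapes : List (Shape k k')
    allShapes = concatMap ofWidth (upTo (ℕ.suc (k + k')))

    ∈-ofWidth⁻ : {σ : Shape k k'} → σ ∈ ofWidth j → width σ ≡ j × IsBlockVector (entries σ)
    ∈-ofWidth⁻ {j} p with find (∈P.∈-concatMap⁻ withInterleaving {xs = interleavings k k' j} p)
    ... | ω , _ , q with ∈P.∈-map⁻ (ω ⋈_) q
    ... | v , v∈ , refl = refl , ∈-blockVectors⁻ v∈

    allShapes-unique : Unique allShapes
    allShapes-unique = unique-concatMap⁺ ofWidth (UniqueP.upTo⁺ _) ofWidth-unique
      (λ _ _ p q → trans (sym (proj₁ (∈-ofWidth⁻ p))) (proj₁ (∈-ofWidth⁻ q)))
      where
      ofWidth-unique : ∀ {j} → j ∈ upTo (ℕ.suc (k + k')) → Unique (ofWidth j)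
      ofWidth-unique {j} _ = unique-concatMap⁺ withInterleaving (interleavings-unique k k' j)
        (λ _ → UniqueP.map⁺ (λ { refl → refl }) (blockVectors-unique j)) same-interleaving
        where
        same-interleaving : ∀ {ω ω' σ} → _ → _ → σ ∈ withInterleaving ω → σ ∈ withInterleaving ω' → ω ≡ ω'
        same-interleaving {ω} {ω'} _ _ p q with ∈P.∈-map⁻ (ω ⋈_) p | ∈P.∈-map⁻ (ω' ⋈_) q
        ... | _ , _ , refl | _ , _ , refl = refl

  shapes : List (Shape k k')
  shapes = filter compatible? allShapes

  shapes-unique : Unique shapes
  shapes-unique = UniqueP.filter⁺ compatible? allShapes-unique

  ∈-shapes⁺ : (σ : Shape k k') → IsBlockVector (entries σ) → Compatible σ → σ ∈ shapes
  ∈-shapes⁺ (ω ⋈ v) bv = ∈P.∈-filter⁺ compatible?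
    (∈P.∈-concatMap⁺ ofWidth (lose (∈P.∈-upTo⁺ (ℕ.s≤s (interleaving-length ω)))
      (∈P.∈-concatMap⁺ withInterleaving (lose (∈-interleavings ω) (∈P.∈-map⁺ (ω ⋈_) (∈-blockVectors⁺ bv))))))

  ∈-shapes⁻ : {σ : Shape k k'} → σ ∈ shapes → IsBlockVector (entries σ) × Compatible σ
  ∈-shapes⁻ p with ∈P.∈-filter⁻ compatible? {xs = allShapes} p
  ... | σ∈ , compatible with find (∈P.∈-concatMap⁻ ofWidth {xs = upTo (ℕ.suc (k + k'))} σ∈)
  ... | _ , _ , q = proj₂ (∈-ofWidth⁻ q) , compatible

  module _ (λ' : SetPartition n) where

    restrictˡ : (σ : Shape k k') {w : Vec (Fin n) (width σ)} → Compatible σ →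
      Occurrence (patternOf σ) λ' w → Occurrence p₁ λ' (splitˡ (interleaving σ) w)
    restrictˡ (ω ⋈ v) {w} (agreeˡ , _) o = record
      { increasing = sorted⇒lookup-< (sorted-splitˡ ω (lookup-<⇒sorted w (Occurrence.increasing o)))
      ; same-block = toSameBlocks (BlocksAgree-resp-≗ (sym ∘ lookup-splitˡ ω w) (BlocksAgree-∘ (occurrence-blocksAgree o) agreeˡ))
      ; firsts     = All-map⁻-reindex (First λ') (lookup w) (lookup-splitˡ ω w) (AllP.++⁻ˡ _ (Occurrence.firsts o))
      ; lasts      = All-map⁻-reindex (Last λ') (lookup w) (lookup-splitˡ ω w) (AllP.++⁻ˡ _ (Occurrence.lasts o))
      ; arcs       = All-map⁻-reindex (uncurry (Arc λ')) (lookup² w) (lookup²-splitˡ ω w) (AllP.++⁻ˡ _ (Occurrence.arcs o))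
      ; adjacents  = All-map⁻-reindex (uncurry Adjacent) (lookup² w) (lookup²-splitˡ ω w) (AllP.++⁻ˡ _ (Occurrence.adjacents o))
      }

    restrictʳ : (σ : Shape k k') {w : Vec (Fin n) (width σ)} → Compatible σ →
      Occurrence (patternOf σ) λ' w → Occurrence p₂ λ' (splitʳ (interleaving σ) w)
    restrictʳ (ω ⋈ v) {w} (_ , agreeʳ) o = record
      { increasing = sorted⇒lookup-< (sorted-splitʳ ω (lookup-<⇒sorted w (Occurrence.increasing o)))
      ; same-block = toSameBlocks (BlocksAgree-resp-≗ (sym ∘ lookup-splitʳ ω w) (BlocksAgree-∘ (occurrence-blocksAgree o) agreeʳ))
      ; firsts     = All-map⁻-reindex (First λ') (lookup w) (lookup-splitʳ ω w) (AllP.++⁻ʳ (map (embedˡ ω) (F p₁)) (Occurrence.firsts o))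
      ; lasts      = All-map⁻-reindex (Last λ') (lookup w) (lookup-splitʳ ω w) (AllP.++⁻ʳ (map (embedˡ ω) (L p₁)) (Occurrence.lasts o))
      ; arcs       = All-map⁻-reindex (uncurry (Arc λ')) (lookup² w) (lookup²-splitʳ ω w)
                       (AllP.++⁻ʳ (map (map² (embedˡ ω)) (A p₁)) (Occurrence.arcs o))
      ; adjacents  = All-map⁻-reindex (uncurry Adjacent) (lookup² w) (lookup²-splitʳ ω w)
                       (AllP.++⁻ʳ (map (map² (embedˡ ω)) (C p₁)) (Occurrence.adjacents o))
      }

    combine : (ω : Interleaving k k' j) {w : Vec (Fin n) j} → Sorted w →
      Occurrence p₁ λ' (splitˡ ω w) → Occurrence p₂ λ' (splitʳ ω w) →
      Compatible (ω ⋈ inducedBlocks λ' w) × Occurrence (patternOf (ω ⋈ inducedBlocks λ' w)) λ' w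
    combine ω {w} sw o₁ o₂ = (agreeˡ , agreeʳ) , record
      { increasing = sorted⇒lookup-< sw
      ; same-block = toSameBlocks (inducedBlocks-agree λ' w)
      ; firsts     = AllP.++⁺ (All-map⁺-reindex (First λ') (lookup w) (lookup-splitˡ ω w) (Occurrence.firsts o₁))
                              (All-map⁺-reindex (First λ') (lookup w) (lookup-splitʳ ω w) (Occurrence.firsts o₂))
      ; lasts      = AllP.++⁺ (All-map⁺-reindex (Last λ') (lookup w) (lookup-splitˡ ω w) (Occurrence.lasts o₁))
                              (All-map⁺-reindex (Last λ') (lookup w) (lookup-splitʳ ω w) (Occurrence.lasts o₂))
      ; arcs       = AllP.++⁺ (All-map⁺-reindex (uncurry (Arc λ')) (lookup² w) (lookup²-splitˡ ω w) (Occurrence.arcs o₁))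
                              (All-map⁺-reindex (uncurry (Arc λ')) (lookup² w) (lookup²-splitʳ ω w) (Occurrence.arcs o₂))
      ; adjacents  = AllP.++⁺ (All-map⁺-reindex (uncurry Adjacent) (lookup² w) (lookup²-splitˡ ω w) (Occurrence.adjacents o₁))
                              (All-map⁺-reindex (uncurry Adjacent) (lookup² w) (lookup²-splitʳ ω w) (Occurrence.adjacents o₂))
      }
      where
      agreeˡ : BlocksAgree (toPartition (inducedBlocks λ' w)) (P p₁) (embedˡ ω)
      agreeˡ = BlocksAgree-cancelˡ (inducedBlocks-agree λ' w)
                 (BlocksAgree-resp-≗ (lookup-splitˡ ω w) (occurrence-blocksAgree o₁))
      agreeʳ : BlocksAgree (toPartition (inducedBlocks λ' w)) (P p₂) (embedʳ ω)
      agreeʳ = BlocksAgree-cancelˡ (inducedBlocks-agree λ' w)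
                 (BlocksAgree-resp-≗ (lookup-splitʳ ω w) (occurrence-blocksAgree o₂))

    pairs : List (Vec (Fin n) k × Vec (Fin n) k')
    pairs = cartesianProduct (occurrences p₁ λ') (occurrences p₂ λ')

    fibre : Shape k k' → List (Vec (Fin n) k × Vec (Fin n) k')
    fibre σ = map (split (interleaving σ)) (occurrences (patternOf σ) λ')

    private
      occurrence-sorted : {pat : Pattern j} {w : Vec (Fin n) j} → Occurrence pat λ' w → Sorted w
      occurrence-sorted {w = w} o = lookup-<⇒sorted w (Occurrence.increasing o)

      ∈-fibres⁻ : ∀ {z} → z ∈ concatMap fibre shapes → z ∈ pairs
      ∈-fibres⁻ z∈ with find (∈P.∈-concatMap⁻ fibre {xs = shapes} z∈)
      ... | σ , σ∈ , q with ∈P.∈-map⁻ (split (interleaving σ)) q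
      ... | w , w∈ , refl = ∈P.∈-cartesianProduct⁺ (∈-occurrences⁺ (restrictˡ σ compatible o))
                                                 (∈-occurrences⁺ (restrictʳ σ compatible o))
        where
        o : Occurrence (patternOf σ) λ' w
        o = ∈-occurrences⁻ w∈
        compatible : Compatible σ
        compatible = proj₂ (∈-shapes⁻ σ∈)

      ∈-fibres⁺ : ∀ {z} → z ∈ pairs → z ∈ concatMap fibre shapes
      ∈-fibres⁺ {x , y} z∈ with ∈P.∈-cartesianProduct⁻ (occurrences p₁ λ') (occurrences p₂ λ') z∈
      ... | x∈ , y∈ = subst (_∈ concatMap fibre shapes) (split-merge x y)
        (∈P.∈-concatMap⁺ fibre (lose (∈-shapes⁺ (ω ⋈ inducedBlocks λ' w) (inducedBlocks-isBlockVector λ' w) (proj₁ combined))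
          (∈P.∈-map⁺ (split ω) (∈-occurrences⁺ (proj₂ combined)))))
        where
        m : Interleaved (Vec (Fin n)) k k'
        m = merge x y
        ω : Interleaving k k' (width m)
        ω = interleaving m
        w : Vec (Fin n) (width m)
        w = entries m
        o₁ : Occurrence p₁ λ' x
        o₁ = ∈-occurrences⁻ x∈
        o₂ : Occurrence p₂ λ' y
        o₂ = ∈-occurrences⁻ y∈
        combined : Compatible (ω ⋈ inducedBlocks λ' w) × Occurrence (patternOf (ω ⋈ inducedBlocks λ' w)) λ' w
        combined = combine ω (sorted-merge (occurrence-sorted o₁) (occurrence-sorted o₂))
          (subst (Occurrence p₁ λ') (sym (cong proj₁ (split-merge x y))) o₁)
          (subst (Occurrence p₂ λ') (sym (cong proj₂ (split-merge x y))) o₂)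

    ∈-fibres⇔ : ∀ {z} → z ∈ pairs ⇔ z ∈ concatMap fibre shapes
    ∈-fibres⇔ = mk⇔ ∈-fibres⁺ ∈-fibres⁻

    -- A pair of sorted tuples determines its merge, and hence the whole shape.
    fibres-unique : Unique (concatMap fibre shapes)
    fibres-unique = unique-concatMap⁺ fibre shapes-unique
      (λ {σ} _ → UniqueP.map⁺ (split-injective (interleaving σ)) (occurrences-unique (patternOf σ) λ'))
      disjoint
      where
      disjoint : ∀ {σ σ' z} → σ ∈ shapes → σ' ∈ shapes → z ∈ fibre σ → z ∈ fibre σ' → σ ≡ σ'
      disjoint {ω ⋈ v} {ω' ⋈ v'} σ∈ σ'∈ p q
        with ∈P.∈-map⁻ (split ω) p | ∈P.∈-map⁻ (split ω') q
      ... | w , w∈ , refl | w' , w'∈ , same-split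
        with o ← ∈-occurrences⁻ w∈ | o' ← ∈-occurrences⁻ w'∈
        with refl ← trans (sym (merge-split ω (occurrence-sorted o)))
                      (trans (cong (uncurry merge) same-split) (merge-split ω' (occurrence-sorted o')))
        = cong (ω ⋈_) (blockVector-unique (proj₁ (∈-shapes⁻ σ∈)) (proj₁ (∈-shapes⁻ σ'∈))
            (BlocksAgree-unique (occurrence-blocksAgree o) (occurrence-blocksAgree o')))

-- Products of polynomials along an interleaving

mergeExponents : Interleaving k k' j → Vec ℕ k → Vec ℕ k' → Vec ℕ j
mergeExponents []        []       []        = []
mergeExponents (left ω)  (e ∷ es) es'       = e ∷ mergeExponents ω es es'
mergeExponents (right ω) es       (e' ∷ es') = e' ∷ mergeExponents ω es es'
mergeExponents (both ω)  (e ∷ es) (e' ∷ es') = e + e' ∷ mergeExponents ω es es'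

mulMonomial : Interleaving k k' j → Monomial k → Monomial k' → Monomial j
mulMonomial ω μ μ' = record
  { coeff = coeff μ ℤ.* coeff μ'
  ; expY  = mergeExponents ω (expY μ) (expY μ')
  ; expM  = expM μ + expM μ'
  }

mulPoly : Interleaving k k' j → Poly k → Poly k' → Poly j
mulPoly ω Q Q' = concatMap (λ μ → map (mulMonomial ω μ) Q') Q

powers : Vec (Fin n) k → Vec ℕ k → ℕ
powers x es = ℕList.product (Vec.toList (Vec.zipWith (λ xi e → (toℕ xi + 1) ℕ.^ e) x es))

module _ where
  open CommSemigroupProperties ℕP.*-commutativeSemigroup using (interchange; x∙yz≈y∙xz)

  powers-merge : (ω : Interleaving k k' j) (w : Vec (Fin n) j) (es : Vec ℕ k) (es' : Vec ℕ k') →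
    powers w (mergeExponents ω es es') ≡ powers (splitˡ ω w) es ℕ.* powers (splitʳ ω w) es'
  powers-merge []        []      []       []         = refl
  powers-merge (left ω)  (a ∷ w) (e ∷ es) es'        =
    trans (cong ((toℕ a + 1) ℕ.^ e ℕ.*_) (powers-merge ω w es es')) (sym (ℕP.*-assoc ((toℕ a + 1) ℕ.^ e) (powers (splitˡ ω w) es) (powers (splitʳ ω w) es')))
  powers-merge (right ω) (a ∷ w) es       (e' ∷ es') =
    trans (cong ((toℕ a + 1) ℕ.^ e' ℕ.*_) (powers-merge ω w es es')) (x∙yz≈y∙xz ((toℕ a + 1) ℕ.^ e') (powers (splitˡ ω w) es) (powers (splitʳ ω w) es'))
  powers-merge (both ω)  (a ∷ w) (e ∷ es) (e' ∷ es') =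
    trans (cong₂ ℕ._*_ (ℕP.^-distribˡ-+-* (toℕ a + 1) e e') (powers-merge ω w es es'))
          (interchange ((toℕ a + 1) ℕ.^ e) ((toℕ a + 1) ℕ.^ e') (powers (splitˡ ω w) es) (powers (splitʳ ω w) es'))

  evalMono-mul : (ω : Interleaving k k' j) (μ : Monomial k) (μ' : Monomial k') (w : Vec (Fin n) j) →
    evalMono (mulMonomial ω μ μ') w ≡ evalMono μ (splitˡ ω w) ℤ.* evalMono μ' (splitʳ ω w)
  evalMono-mul {k} {k'} {n = n} ω μ μ' w = begin
    (coeff μ ℤ.* coeff μ') ℤ.* ℤ.+ (powers w (mergeExponents ω (expY μ) (expY μ')) ℕ.* n ℕ.^ (expM μ + expM μ'))
      ≡⟨ cong (λ t → (coeff μ ℤ.* coeff μ') ℤ.* ℤ.+ t)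
           (trans (cong₂ ℕ._*_ (powers-merge ω w (expY μ) (expY μ')) (ℕP.^-distribˡ-+-* n (expM μ) (expM μ')))
                  (interchange (powers x (expY μ)) (powers y (expY μ')) (n ℕ.^ expM μ) (n ℕ.^ expM μ'))) ⟩
    (coeff μ ℤ.* coeff μ') ℤ.* ℤ.+ (valueˡ ℕ.* valueʳ)
      ≡⟨ cong ((coeff μ ℤ.* coeff μ') ℤ.*_) (ℤP.pos-* valueˡ valueʳ) ⟩
    (coeff μ ℤ.* coeff μ') ℤ.* (ℤ.+ valueˡ ℤ.* ℤ.+ valueʳ)
      ≡⟨ ℤinterchange (coeff μ) (coeff μ') (ℤ.+ valueˡ) (ℤ.+ valueʳ) ⟩
    evalMono μ x ℤ.* evalMono μ' y ∎
    where
    open ≡-Reasoning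
    open CommSemigroupProperties ℤP.*-commutativeSemigroup using () renaming (interchange to ℤinterchange)
    x : Vec (Fin n) k
    x = splitˡ ω w
    y : Vec (Fin n) k'
    y = splitʳ ω w
    valueˡ valueʳ : ℕ
    valueˡ = powers x (expY μ) ℕ.* n ℕ.^ expM μ
    valueʳ = powers y (expY μ') ℕ.* n ℕ.^ expM μ'

evalPoly-mul : (ω : Interleaving k k' j) (Q : Poly k) (Q' : Poly k') (w : Vec (Fin n) j) →
  evalPoly (mulPoly ω Q Q') w ≡ evalPoly Q (splitˡ ω w) ℤ.* evalPoly Q' (splitʳ ω w)
evalPoly-mul {k} {k'} {n = n} ω Q Q' w = begin
  ℤΣ.sumBy (λ ν → evalMono ν w) (mulPoly ω Q Q')
    ≡⟨ ℤΣ.sumBy-concatMap (λ ν → evalMono ν w) _ Q ⟩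
  ℤΣ.sumBy (λ μ → ℤΣ.sumBy (λ ν → evalMono ν w) (map (mulMonomial ω μ) Q')) Q
    ≡⟨ ℤΣ.sumBy-cong Q (λ μ _ → begin
         ℤΣ.sumBy (λ ν → evalMono ν w) (map (mulMonomial ω μ) Q')
           ≡⟨ ℤΣ.sumBy-map (λ ν → evalMono ν w) (mulMonomial ω μ) Q' ⟩
         ℤΣ.sumBy (λ μ' → evalMono (mulMonomial ω μ μ') w) Q'
           ≡⟨ ℤΣ.sumBy-cong Q' (λ μ' _ → evalMono-mul ω μ μ' w) ⟩
         ℤΣ.sumBy (λ μ' → evalMono μ x ℤ.* evalMono μ' y) Q'
           ≡⟨ ℤΣ.*-distribˡ-sumBy (evalMono μ x) (λ μ' → evalMono μ' y) Q' ⟨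
         evalMono μ x ℤ.* evalPoly Q' y ∎) ⟩
  ℤΣ.sumBy (λ μ → evalMono μ x ℤ.* evalPoly Q' y) Q
    ≡⟨ ℤΣ.*-distribʳ-sumBy (evalPoly Q' y) (λ μ → evalMono μ x) Q ⟨
  evalPoly Q x ℤ.* evalPoly Q' y ∎
  where
  open ≡-Reasoning
  x : Vec (Fin n) k
  x = splitˡ ω w
  y : Vec (Fin n) k'
  y = splitʳ ω w

module _ where
  open CommSemigroupProperties ℕP.+-commutativeSemigroup using (interchange; x∙yz≈y∙xz)

  sum-mergeExponents : (ω : Interleaving k k' j) (es : Vec ℕ k) (es' : Vec ℕ k') →
    Vec.sum (mergeExponents ω es es') ≡ Vec.sum es + Vec.sum es'
  sum-mergeExponents []        []       []         = refl
  sum-mergeExponents (left ω)  (e ∷ es) es'        =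
    trans (cong (e +_) (sum-mergeExponents ω es es')) (sym (ℕP.+-assoc e (Vec.sum es) (Vec.sum es')))
  sum-mergeExponents (right ω) es       (e' ∷ es') =
    trans (cong (e' +_) (sum-mergeExponents ω es es')) (x∙yz≈y∙xz e' (Vec.sum es) (Vec.sum es'))
  sum-mergeExponents (both ω)  (e ∷ es) (e' ∷ es') =
    trans (cong (e + e' +_) (sum-mergeExponents ω es es')) (interchange e e' (Vec.sum es) (Vec.sum es'))

  monoDeg-mul : (ω : Interleaving k k' j) (μ : Monomial k) (μ' : Monomial k') →
    monoDeg (mulMonomial ω μ μ') ≡ monoDeg μ + monoDeg μ'
  monoDeg-mul ω μ μ' = trans (cong (_+ (expM μ + expM μ')) (sum-mergeExponents ω (expY μ) (expY μ')))
                             (interchange (Vec.sum (expY μ)) (Vec.sum (expY μ')) (expM μ) (expM μ'))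

polyDeg-mul : (ω : Interleaving k k' j) (Q : Poly k) (Q' : Poly k') → polyDeg (mulPoly ω Q Q') ℕ.≤ polyDeg Q + polyDeg Q'
polyDeg-mul ω Q Q' = maxBy-≤ monoDeg (mulPoly ω Q Q') bound
  where
  bound : ∀ ν → ν ∈ mulPoly ω Q Q' → monoDeg ν ℕ.≤ polyDeg Q + polyDeg Q'
  bound ν ν∈ with find (∈P.∈-concatMap⁻ (λ μ → map (mulMonomial ω μ) Q') {xs = Q} ν∈)
  ... | μ , μ∈ , q with ∈P.∈-map⁻ (mulMonomial ω μ) q
  ... | μ' , μ'∈ , refl = subst (ℕ._≤ polyDeg Q + polyDeg Q') (sym (monoDeg-mul ω μ μ'))
                                (ℕP.+-mono-≤ (≤-maxBy monoDeg Q μ∈) (≤-maxBy monoDeg Q' μ'∈))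

simpleValue : Simple → (n : ℕ) → SetPartition n → ℤ.ℤ
simpleValue s n λ' = ℤΣ.sumBy (evalPoly (pol s)) (occurrences (pat s) λ')

module SimpleProduct (s₁ s₂ : Simple) where
  open ProductPattern (pat s₁) (pat s₂)

  simpleOf : Shape (len s₁) (len s₂) → Simple
  simpleOf σ = record { len = width σ ; pat = patternOf σ ; pol = mulPoly (interleaving σ) (pol s₁) (pol s₂) }

  products : List Simple
  products = map simpleOf shapes

  simpleValue-* : ∀ n (λ' : SetPartition n) →
    simpleValue s₁ n λ' ℤ.* simpleValue s₂ n λ' ≡ ℤΣ.sumBy (λ t → simpleValue t n λ') products
  simpleValue-* n λ' = begin
    simpleValue s₁ n λ' ℤ.* simpleValue s₂ n λ'
      ≡⟨ ℤΣ.sumBy-cartesianProduct (evalPoly (pol s₁)) (evalPoly (pol s₂)) (occurrences (pat s₁) λ') (occurrences (pat s₂) λ') ⟩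
    ℤΣ.sumBy valueOfPair (pairs λ')
      ≡⟨ ℤΣ.sumBy-unique valueOfPair
           (UniqueP.cartesianProduct⁺ (occurrences-unique (pat s₁) λ') (occurrences-unique (pat s₂) λ'))
           (fibres-unique λ') (∈-fibres⇔ λ') ⟩
    ℤΣ.sumBy valueOfPair (concatMap (fibre λ') shapes)
      ≡⟨ ℤΣ.sumBy-concatMap valueOfPair (fibre λ') shapes ⟩
    ℤΣ.sumBy (ℤΣ.sumBy valueOfPair ∘ fibre λ') shapes
      ≡⟨ ℤΣ.sumBy-cong shapes (λ σ _ → fibreValue σ) ⟩
    ℤΣ.sumBy (λ σ → simpleValue (simpleOf σ) n λ') shapes
      ≡⟨ ℤΣ.sumBy-map (λ t → simpleValue t n λ') simpleOf shapes ⟨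
    ℤΣ.sumBy (λ t → simpleValue t n λ') products ∎
    where
    open ≡-Reasoning
    valueOfPair : Vec (Fin n) (len s₁) × Vec (Fin n) (len s₂) → ℤ.ℤ
    valueOfPair (x , y) = evalPoly (pol s₁) x ℤ.* evalPoly (pol s₂) y
    fibreValue : ∀ σ → ℤΣ.sumBy valueOfPair (fibre λ' σ) ≡ simpleValue (simpleOf σ) n λ'
    fibreValue σ = trans (ℤΣ.sumBy-map valueOfPair (split (interleaving σ)) (occurrences (patternOf σ) λ'))
      (ℤΣ.sumBy-cong (occurrences (patternOf σ) λ') (λ w _ → sym (evalPoly-mul (interleaving σ) (pol s₁) (pol s₂) w)))

  evalSimple-* : ∀ n (λ' : SetPartition n) →
    evalSimple s₁ n λ' * evalSimple s₂ n λ' ≡ ℚΣ.sumBy (λ t → evalSimple t n λ') products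
  evalSimple-* n λ' = begin
    toℚ (simpleValue s₁ n λ') * toℚ (simpleValue s₂ n λ')    ≡⟨ toℚ-* (simpleValue s₁ n λ') (simpleValue s₂ n λ') ⟨
    toℚ (simpleValue s₁ n λ' ℤ.* simpleValue s₂ n λ')       ≡⟨ cong toℚ (simpleValue-* n λ') ⟩
    toℚ (ℤΣ.sumBy (λ t → simpleValue t n λ') products)      ≡⟨ toℚ-sumBy (λ t → simpleValue t n λ') products ⟩
    ℚΣ.sumBy (λ t → evalSimple t n λ') products              ∎
    where open ≡-Reasoning

  products-degree : ∀ {t} → t ∈ products → simpleDeg t ℕ.≤ simpleDeg s₁ + simpleDeg s₂
  products-degree t∈ with ∈P.∈-map⁻ simpleOf t∈
  ... | _⋈_ {j} ω _ , _ , refl = begin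
    j + polyDeg (mulPoly ω (pol s₁) (pol s₂))
      ≤⟨ ℕP.+-mono-≤ (interleaving-length ω) (polyDeg-mul ω (pol s₁) (pol s₂)) ⟩
    (len s₁ + len s₂) + (polyDeg (pol s₁) + polyDeg (pol s₂))
      ≡⟨ interchange (len s₁) (len s₂) (polyDeg (pol s₁)) (polyDeg (pol s₂)) ⟩
    simpleDeg s₁ + simpleDeg s₂ ∎
    where
    open ℕP.≤-Reasoning
    open CommSemigroupProperties ℕP.+-commutativeSemigroup using (interchange)

term : (n : ℕ) → SetPartition n → ℚ × Simple → ℚ
term n λ' (c , s) = c * evalSimple s n λ'

scaleRep : ℚ → Rep → Rep
scaleRep a = map (λ (cs : ℚ × Simple) → a * proj₁ cs , proj₂ cs)

mulTerm : ℚ × Simple → ℚ × Simple → Rep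
mulTerm (c , s) (c' , s') = map (c * c' ,_) (SimpleProduct.products s s')

mulRep : Rep → Rep → Rep
mulRep R R' = concatMap (λ cs → concatMap (mulTerm cs) R') R

⟦scaleRep⟧ : ∀ a R n λ' → ⟦ scaleRep a R ⟧ n λ' ≡ a * ⟦ R ⟧ n λ'
⟦scaleRep⟧ a R n λ' = begin
  ⟦ scaleRep a R ⟧ n λ'                           ≡⟨ ℚΣ.sumBy-map (term n λ') (λ cs → a * proj₁ cs , proj₂ cs) R ⟩
  ℚΣ.sumBy (λ cs → (a * proj₁ cs) * evalSimple (proj₂ cs) n λ') R
    ≡⟨ ℚΣ.sumBy-cong R (λ cs _ → ℚP.*-assoc a (proj₁ cs) (evalSimple (proj₂ cs) n λ')) ⟩
  ℚΣ.sumBy (λ cs → a * term n λ' cs) R            ≡⟨ ℚΣ.*-distribˡ-sumBy a (term n λ') R ⟨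
  a * ⟦ R ⟧ n λ'                                  ∎
  where open ≡-Reasoning

⟦++⟧ : ∀ R R' n λ' → ⟦ R ++ R' ⟧ n λ' ≡ ⟦ R ⟧ n λ' +ℚ ⟦ R' ⟧ n λ'
⟦++⟧ R R' n λ' = ℚΣ.sumBy-++ (term n λ') R R'

⟦mulRep⟧ : ∀ R R' n λ' → ⟦ mulRep R R' ⟧ n λ' ≡ ⟦ R ⟧ n λ' * ⟦ R' ⟧ n λ'
⟦mulRep⟧ R R' n λ' = begin
  ⟦ mulRep R R' ⟧ n λ'
    ≡⟨ ℚΣ.sumBy-concatMap (term n λ') (λ cs → concatMap (mulTerm cs) R') R ⟩
  ℚΣ.sumBy (λ cs → ℚΣ.sumBy (term n λ') (concatMap (mulTerm cs) R')) R
    ≡⟨ ℚΣ.sumBy-cong R (λ cs _ → trans (ℚΣ.sumBy-concatMap (term n λ') (mulTerm cs) R')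
         (trans (ℚΣ.sumBy-cong R' (λ cs' _ → ⟦mulTerm⟧ cs cs')) (sym (ℚΣ.*-distribˡ-sumBy (term n λ' cs) (term n λ') R')))) ⟩
  ℚΣ.sumBy (λ cs → term n λ' cs * ⟦ R' ⟧ n λ') R
    ≡⟨ ℚΣ.*-distribʳ-sumBy (⟦ R' ⟧ n λ') (term n λ') R ⟨
  ⟦ R ⟧ n λ' * ⟦ R' ⟧ n λ' ∎
  where
  open ≡-Reasoning
  open CommSemigroupProperties (CommutativeMonoid.commutativeSemigroup ℚP.*-1-commutativeMonoid) using (interchange)
  ⟦mulTerm⟧ : ∀ cs cs' → ℚΣ.sumBy (term n λ') (mulTerm cs cs') ≡ term n λ' cs * term n λ' cs'
  ⟦mulTerm⟧ (c , s) (c' , s') = begin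
    ℚΣ.sumBy (term n λ') (map (c * c' ,_) products)
      ≡⟨ ℚΣ.sumBy-map (term n λ') (c * c' ,_) products ⟩
    ℚΣ.sumBy (λ t → (c * c') * evalSimple t n λ') products
      ≡⟨ ℚΣ.*-distribˡ-sumBy (c * c') (λ t → evalSimple t n λ') products ⟨
    (c * c') * ℚΣ.sumBy (λ t → evalSimple t n λ') products
      ≡⟨ cong ((c * c') *_) (evalSimple-* n λ') ⟨
    (c * c') * (evalSimple s n λ' * evalSimple s' n λ')
      ≡⟨ interchange c c' (evalSimple s n λ') (evalSimple s' n λ') ⟩
    term n λ' (c , s) * term n λ' (c' , s') ∎
    where open SimpleProduct s s'

repDeg-scaleRep : ∀ a R → repDeg (scaleRep a R) ≡ repDeg R
repDeg-scaleRep a []       = refl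
repDeg-scaleRep a (_ ∷ R) = cong (_ ⊔_) (repDeg-scaleRep a R)

repDeg-++ : ∀ R R' → repDeg (R ++ R') ≡ repDeg R ⊔ repDeg R'
repDeg-++ []       R' = refl
repDeg-++ (cs ∷ R) R' = trans (cong (simpleDeg (proj₂ cs) ⊔_) (repDeg-++ R R')) (sym (ℕP.⊔-assoc (simpleDeg (proj₂ cs)) (repDeg R) (repDeg R')))

repDeg-mulRep : ∀ R R' → repDeg (mulRep R R') ℕ.≤ repDeg R + repDeg R'
repDeg-mulRep R R' = maxBy-≤ (simpleDeg ∘ proj₂) (mulRep R R') bound
  where
  bound : ∀ cs → cs ∈ mulRep R R' → simpleDeg (proj₂ cs) ℕ.≤ repDeg R + repDeg R'
  bound cs cs∈ with find (∈P.∈-concatMap⁻ (λ cs → concatMap (mulTerm cs) R') {xs = R} cs∈)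
  ... | (c₁ , s₁) , cs₁∈ , q with find (∈P.∈-concatMap⁻ (mulTerm (c₁ , s₁)) {xs = R'} q)
  ... | (c₂ , s₂) , cs₂∈ , r with ∈P.∈-map⁻ (c₁ * c₂ ,_) r
  ... | t , t∈ , refl = ℕP.≤-trans (SimpleProduct.products-degree s₁ s₂ t∈)
    (ℕP.+-mono-≤ (≤-maxBy (simpleDeg ∘ proj₂) R cs₁∈) (≤-maxBy (simpleDeg ∘ proj₂) R' cs₂∈))

module _ {f₁ f₂ : Stat} {D₁ D₂ : ℕ} (deg₁ : DegreeAtMost f₁ D₁) (deg₂ : DegreeAtMost f₂ D₂) where
  private
    R₁ R₂ : Rep
    R₁ = proj₁ deg₁
    R₂ = proj₁ deg₂

  degreeAtMost-+ : DegreeAtMost (λ n λ' → f₁ n λ' +ℚ f₂ n λ') (D₁ ⊔ D₂)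
  degreeAtMost-+ = R₁ ++ R₂
    , (λ n λ' → trans (⟦++⟧ R₁ R₂ n λ') (cong₂ _+ℚ_ (proj₁ (proj₂ deg₁) n λ') (proj₁ (proj₂ deg₂) n λ')))
    , ℕP.≤-trans (ℕP.≤-reflexive (repDeg-++ R₁ R₂)) (ℕP.⊔-mono-≤ (proj₂ (proj₂ deg₁)) (proj₂ (proj₂ deg₂)))

  degreeAtMost-* : DegreeAtMost (λ n λ' → f₁ n λ' * f₂ n λ') (D₁ + D₂)
  degreeAtMost-* = mulRep R₁ R₂
    , (λ n λ' → trans (⟦mulRep⟧ R₁ R₂ n λ') (cong₂ _*_ (proj₁ (proj₂ deg₁) n λ') (proj₁ (proj₂ deg₂) n λ')))
    , ℕP.≤-trans (repDeg-mulRep R₁ R₂) (ℕP.+-mono-≤ (proj₂ (proj₂ deg₁)) (proj₂ (proj₂ deg₂)))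

degreeAtMost-scale : ∀ a {f D} → DegreeAtMost f D → DegreeAtMost (λ n λ' → a * f n λ') D
degreeAtMost-scale a (R , R≡f , R≤D) =
  scaleRep a R , (λ n λ' → trans (⟦scaleRep⟧ a R n λ') (cong (a *_) (R≡f n λ'))) , subst (ℕ._≤ _) (sym (repDeg-scaleRep a R)) R≤D

statistic⇒degreeAtMost : {f : Stat} (s : IsStatistic f) → DegreeAtMost f (repDeg (proj₁ s))
statistic⇒degreeAtMost (R , R≡f) = R , R≡f , ℕP.≤-refl

degreeAtMost⇒statistic : {f : Stat} {D : ℕ} → DegreeAtMost f D → IsStatistic f
degreeAtMost⇒statistic (R , R≡f , _) = R , R≡f

theorem2p2 : (f₁ f₂ : Stat) → IsStatistic f₁ → IsStatistic f₂ → (a : ℚ) →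
    Σ Stat λ gₐ → Σ Stat λ g₊ → Σ Stat λ g* →
      (IsStatistic gₐ × IsStatistic g₊ × IsStatistic g*)
      × (∀ n λ' → a * f₁ n λ' ≡ gₐ n λ')
      × (∀ n λ' → f₁ n λ' +ℚ f₂ n λ' ≡ g₊ n λ')
      × (∀ n λ' → f₁ n λ' * f₂ n λ' ≡ g* n λ')
      × (∀ D → DegreeAtMost f₁ D → DegreeAtMost gₐ D)
      × (∀ D₁ D₂ → DegreeAtMost f₁ D₁ → DegreeAtMost f₂ D₂ → DegreeAtMost g₊ (D₁ ⊔ D₂))
      × (∀ D₁ D₂ → DegreeAtMost f₁ D₁ → DegreeAtMost f₂ D₂ → DegreeAtMost g* (D₁ + D₂))
theorem2p2 f₁ f₂ stat₁ stat₂ a =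
    (λ n λ' → a * f₁ n λ') , (λ n λ' → f₁ n λ' +ℚ f₂ n λ') , (λ n λ' → f₁ n λ' * f₂ n λ')
  , ( degreeAtMost⇒statistic (degreeAtMost-scale a deg₁)
    , degreeAtMost⇒statistic (degreeAtMost-+ deg₁ deg₂)
    , degreeAtMost⇒statistic (degreeAtMost-* deg₁ deg₂) )
  , (λ _ _ → refl) , (λ _ _ → refl) , (λ _ _ → refl)
  , (λ _ → degreeAtMost-scale a)
  , (λ _ _ → degreeAtMost-+)
  , (λ _ _ → degreeAtMost-*)
  where
  deg₁ : DegreeAtMost f₁ (repDeg (proj₁ stat₁))
  deg₁ = statistic⇒degreeAtMost stat₁
  deg₂ : DegreeAtMost f₂ (repDeg (proj₁ stat₂))
  deg₂ = statistic⇒degreeAtMost stat₂
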